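{- Let $G=(V,E)$ be an undirected graph, $k\ge 3$ an integer, $\gamma\ge 7|V|+6$ an integer, $\rho=\gamma$, $G_T=(V_T,E_T)$ the transformed graph described in the context, and $S$ an optimal (minimum-cardinality) solution of $k\rho$-MSP on $G_T$. Then every shortcut $s\in S$ forms at least one $(k,\rho)$-ball for some node $v\in V_{\text{edges}}$ in $(V_T,E_T\cup S)$; that is, there is $v\in V_{\text{edges}}$ which has a $(k,\rho)$-ball in $(V_T,E_T\cup S)$ but not in $(V_T,E_T\cup(S\setminus\{s\}))$.
   Context: For a weighted undirected graph: $d(u,v)$ is the minimum path weight; $\hat d(u,v)$ is the minimum number of edges over paths of weight $d(u,v)$ ($\infty$ if disconnected). $\bar r_k(u)=\min_{v:\ \hat d(u,v)>k} d(u,v)$; $r_\rho(u)$ is the distance to the $\rho$-th closest vertex; $v$ has a $(k,\rho)$-ball iff $r_\rho(v)<\bar r_k(v)$; a $(k,\rho)$-graph is one where every vertex has a $(k,\rho)$-ball. A shortcut between distinct $u,v$ with $d(u,v)<\infty$, $\hat d(u,v)>1$ is a new edge $\{u,v\}$ of weight $d(u,v)$. $k\rho$-MSP: find a minimum-cardinality shortcut set $S$ making $(V,E\cup S)$ a $(k,\rho)$-graph. Construction of $G_T$ (unit weights): replace each edge $\{u,v\}\in E$ by a fresh path $u,s_{k-3},\dots,s_1,w_{u,v},s'_1,\dots,s'_{k-3},v$ (for $k=3$: $u,w_{u,v},v$); $V_{\text{edges}}=\{w_{u,v}\}$. For each $v\in V$ attach a fresh $\gamma$-pitchfork: a star with center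 (base) $b_v$ and $\gamma+1$ satellites, exactly one of which is also adjacent to $v$. -}

module Defs where

open import Data.Nat using (ℕ; zero; suc; _+_; _*_; _∸_; _≤_; _<_)
open import Data.Fin using (Fin; toℕ) renaming (zero to fzero)
open import Data.List using (List; length; lookup)
open import Data.List.Relation.Unary.All using (All)
open import Data.List.Relation.Unary.Any using (Any)
open import Data.List.Relation.Unary.AllPairs using (AllPairs)
open import Data.Product using (Σ; Σ-syntax; ∃; ∃-syntax; _×_; _,_; proj₁; proj₂)
open import Data.Sum using (_⊎_)
open import Data.Empty using (⊥)
open import Data.Unit using (⊤)
open import Relation.Nullary using (¬_)
open import Relation.Binary.PropositionalEquality using (_≡_; _≢_)
open import Function.Definitions using (Injective)

-- Generic weighted undirected graphs on a vertex type V.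
-- An adjacency relation  A u v w  means "there is an edge {u,v} of weight w".
-- (All graphs built below are symmetric.)

Adjacency : Set → Set₁
Adjacency V = V → V → ℕ → Set

data Walk {V : Set} (A : Adjacency V) : V → V → ℕ → ℕ → Set where
  nil  : ∀ {u} → Walk A u u 0 0
  cons : ∀ {u v x w W h} → A u v w → Walk A v x W h → Walk A u x (w + W) (suc h)

Dist : {V : Set} → Adjacency V → V → V → ℕ → Set
Dist A u v d = (∃[ h ] Walk A u v d h) × (∀ d' h' → Walk A u v d' h' → d ≤ d')

Disconnected : {V : Set} → Adjacency V → V → V → Set
Disconnected A u v = ∀ d h → ¬ Walk A u v d h

HopDist : {V : Set} → Adjacency V → V → V → ℕ → ℕ → Set
HopDist A u v d h = Dist A u v d × Walk A u v d h × (∀ h' → Walk A u v d h' → h ≤ h')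

data ℕ∞ : Set where
  fin : ℕ → ℕ∞
  ∞   : ℕ∞

_<∞_ : ℕ∞ → ℕ∞ → Set
fin a <∞ fin b = a < b
fin a <∞ ∞     = ⊤
∞     <∞ _     = ⊥

AtLeast : {V : Set} → ℕ → (V → Set) → Set
AtLeast {V} ρ P = Σ[ f ∈ (Fin ρ → V) ] Injective _≡_ _≡_ f × (∀ i → P (f i))

-- r_ρ(u) = r : the distance from u to its ρ-th closest vertex
-- (vertices sorted by distance from u, u itself counted, at distance 0);
-- ∞ if fewer than ρ vertices are reachable from u.
RRho : {V : Set} → Adjacency V → ℕ → V → ℕ∞ → Set
RRho A ρ u (fin r) =
  AtLeast ρ (λ v → ∃[ d ] Dist A u v d × d ≤ r) ×
  ¬ AtLeast ρ (λ v → ∃[ d ] Dist A u v d × d < r)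
RRho A ρ u ∞ = ¬ AtLeast ρ (λ v → ∃[ d ] Dist A u v d)

-- r̄_k(u) = min { d(u,v) : d̂(u,v) > k }   (∞ if the set is empty or only
-- contains disconnected vertices, whose distance is ∞)
RBar : {V : Set} → Adjacency V → ℕ → V → ℕ∞ → Set
RBar A k u (fin r) =
  (∃[ v ] ∃[ h ] HopDist A u v r h × k < h) ×
  (∀ v d h → HopDist A u v d h → k < h → r ≤ d)
RBar A k u ∞ = ∀ v d h → HopDist A u v d h → ¬ (k < h)

HasBall : {V : Set} → Adjacency V → ℕ → ℕ → V → Set
HasBall A k ρ u = ∃[ a ] ∃[ b ] RRho A ρ u a × RBar A k u b × (a <∞ b)

IsKRhoGraph : {V : Set} → Adjacency V → ℕ → ℕ → Set
IsKRhoGraph {V} A k ρ = ∀ (v : V) → HasBall A k ρ v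

SameEdge : {V : Set} → V × V → V × V → Set
SameEdge (a , b) (c , d) = (a ≡ c × b ≡ d) ⊎ (a ≡ d × b ≡ c)

IsShortcut : {V : Set} → Adjacency V → V × V → Set
IsShortcut A (u , v) =
  u ≢ v × (∃[ d ] Dist A u v d) × (∀ d h → HopDist A u v d h → 1 < h)

-- A shortcut set: a list of pairwise distinct unordered pairs, all shortcuts.
-- Its cardinality is its length.
IsShortcutSet : {V : Set} → Adjacency V → List (V × V) → Set
IsShortcutSet A S = AllPairs (λ p q → ¬ SameEdge p q) S × All (IsShortcut A) S

AddShortcuts : {V : Set} → Adjacency V → List (V × V) → Adjacency V
AddShortcuts A S u v w = A u v w ⊎ (Any (SameEdge (u , v)) S × Dist A u v w)

IsSolution : {V : Set} → Adjacency V → ℕ → ℕ → List (V × V) → Set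
IsSolution A k ρ S = IsShortcutSet A S × IsKRhoGraph (AddShortcuts A S) k ρ

IsOptimalSolution : {V : Set} → Adjacency V → ℕ → ℕ → List (V × V) → Set
IsOptimalSolution {V} A k ρ S =
  IsSolution A k ρ S × (∀ (S' : List (V × V)) → IsSolution A k ρ S' → length S ≤ length S')

SimpleEdgeList : (n : ℕ) → List (Fin n × Fin n) → Set
SimpleEdgeList n E =
  All (λ e → proj₁ e ≢ proj₂ e) E × AllPairs (λ p q → ¬ SameEdge p q) E

-- Edge number i of E, {u,v} = lookup E i, is replaced by the path
--   u, s_{k-3}, …, s_1, w_{u,v}, s'_1, …, s'_{k-3}, v
-- whose 2(k-3)+1 inner vertices are  inner i j , j : Fin (2(k-3)+1), in order
-- from u to v; so inner i j with toℕ j ≡ k-3 is w_{u,v}.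
-- For every v : Fin n a γ-pitchfork: base b_v = base v and γ+1 satellites
-- sat v j (j : Fin (suc γ)); sat v zero is the one also adjacent to v.

data VT (n : ℕ) (E : List (Fin n × Fin n)) (k γ : ℕ) : Set where
  orig  : Fin n → VT n E k γ
  inner : Fin (length E) → Fin (2 * (k ∸ 3) + 1) → VT n E k γ
  base  : Fin n → VT n E k γ
  sat   : Fin n → Fin (suc γ) → VT n E k γ

-- directed description of the edges of G_T (each undirected edge once)
data TEdge (n : ℕ) (E : List (Fin n × Fin n)) (k γ : ℕ) : VT n E k γ → VT n E k γ → Set where
  path-start : ∀ i j → toℕ j ≡ 0 →
               TEdge n E k γ (orig (proj₁ (lookup E i))) (inner i j)
  path-step  : ∀ i j j' → toℕ j' ≡ suc (toℕ j) →
               TEdge n E k γ (inner i j) (inner i j')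
  path-end   : ∀ i j → suc (toℕ j) ≡ 2 * (k ∸ 3) + 1 →
               TEdge n E k γ (inner i j) (orig (proj₂ (lookup E i)))
  fork-tine  : ∀ v j → TEdge n E k γ (base v) (sat v j)
  fork-link  : ∀ v → TEdge n E k γ (sat v fzero) (orig v)

GT : (n : ℕ) (E : List (Fin n × Fin n)) (k γ : ℕ) → Adjacency (VT n E k γ)
GT n E k γ x y w = w ≡ 1 × (TEdge n E k γ x y ⊎ TEdge n E k γ y x)

IsEdgeNode : {n : ℕ} {E : List (Fin n × Fin n)} {k γ : ℕ} → VT n E k γ → Set
IsEdgeNode {k = k} (inner i j) = toℕ j ≡ k ∸ 3
IsEdgeNode (orig _)  = ⊥
IsEdgeNode (base _)  = ⊥
IsEdgeNode (sat _ _) = ⊥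

{-# OPTIONS --safe #-}
-- Every vertex of G_T other than an edge node lies within distance k - 1 of the base of some
-- pitchfork, so at least ρ = γ satellites lie within distance k of it and r_ρ ≤ k.  All weights
-- are positive, so a vertex more than k hops away is more than k away, and r̄_k > k.  Hence such a
-- vertex keeps its (k,ρ)-ball whatever shortcuts are added.  If removing s from an optimal S
-- destroyed no ball, S ∖ {s} would be a smaller solution; so some vertex loses its ball, and it
-- must be an edge node.
--
-- To exhibit that vertex constructively, "has a (k,ρ)-ball" is decided in the finite graph:
-- distances and hop distances are least witnesses of bounded searches, r_ρ is the same before and
-- after the removal (shortcuts do not change distances), and r̄_k after the removal is either
-- witnessed by r̄_k before it or bounded by k times the largest edge weight.
module Submission where

open import Defs

open import Data.Empty using (⊥-elim)
open import Data.Fin using (Fin; toℕ; fromℕ<) renaming (zero to fzero; suc to fsuc)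
import Data.Fin.Properties as Fin
open import Data.List using (List; length; lookup)
open import Data.List.Membership.Propositional using (_∈_; _─_)
open import Data.List.Properties using (length-removeAt′)
open import Data.List.Relation.Unary.All using (All; []; _∷_)
import Data.List.Relation.Unary.All.Properties as All
open import Data.List.Relation.Unary.AllPairs using (AllPairs; _∷_)
open import Data.List.Relation.Unary.Any as Any using (Any; here; there; index)
open import Data.Nat as ℕ using (ℕ; zero; suc; _+_; _*_; _∸_; _⊔_; _≤_; _<_; z≤n; s≤s)
open import Data.Nat.Induction using (<-wellFounded)
open import Data.Nat.Properties hiding (_≟_)
open import Data.Product using (Σ-syntax; ∃; ∃-syntax; ∃₂; _×_; _,_; proj₁; proj₂)
import Data.Product.Properties as Product
open import Data.Sum as Sum using (_⊎_; inj₁; inj₂)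
import Data.Sum.Properties as Sum
open import Data.Unit using (tt)
open import Function using (_∘_)
open import Induction.WellFounded using (Acc; acc)
open import Relation.Binary.Definitions using (DecidableEquality; tri<; tri≈; tri>)
open import Relation.Binary.PropositionalEquality
  using (_≡_; _≢_; refl; sym; trans; cong; subst; subst₂)
open import Relation.Nullary using (¬_; Dec; yes; no; contradiction)
open import Relation.Nullary.Decidable using (map′; _×-dec_; _⊎-dec_; ¬?; decidable-stable)
open import Relation.Unary using (Decidable)

-- Finite search

Searchable : Set → Set₁
Searchable A = ∀ {P : A → Set} → Decidable P → Dec (∃ P)

module _ {A B : Set} where

  search-⊎ : Searchable A → Searchable B → Searchable (A ⊎ B)
  search-⊎ searchA searchB P? =
    map′ (λ { (inj₁ (a , p)) → inj₁ a , p ; (inj₂ (b , p)) → inj₂ b , p })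
         (λ { (inj₁ a , p) → inj₁ (a , p) ; (inj₂ b , p) → inj₂ (b , p) })
         (searchA (P? ∘ inj₁) ⊎-dec searchB (P? ∘ inj₂))

  search-× : Searchable A → Searchable B → Searchable (A × B)
  search-× searchA searchB P? =
    map′ (λ (a , b , p) → (a , b) , p) (λ ((a , b) , p) → a , b , p)
         (searchA λ a → searchB λ b → P? (a , b))

  module _ (encode : B → A) (decode : A → B) (decode-encode : ∀ b → decode (encode b) ≡ b) where

    search-retract : Searchable A → Searchable B
    search-retract searchA {P} P? =
      map′ (λ (a , p) → decode a , p) (λ (b , p) → encode b , subst P (sym (decode-encode b)) p)
           (searchA (P? ∘ decode))

    ≡-dec-retract : DecidableEquality A → DecidableEquality B
    ≡-dec-retract _≟_ x y =
      map′ (λ e → trans (sym (decode-encode x)) (trans (cong decode e) (decode-encode y)))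
           (cong encode) (encode x ≟ encode y)

Least : (ℕ → Set) → ℕ → Set
Least P r = P r × (∀ {m} → m < r → ¬ P m)

module _ {P : ℕ → Set} where

  least-≤ : ∀ {r m} → Least P r → P m → r ≤ m
  least-≤ (_ , below) pm = ≮⇒≥ λ m<r → below m<r pm

  least? : Decidable P → Decidable (Least P)
  least? P? r = P? r ×-dec allUpTo? (¬? ∘ P?) r

  least : Decidable P → ∀ {m} → P m → ∃ (Least P)
  least P? {m} pm = go (<-wellFounded m) pm
    where
    go : ∀ {m} → Acc _<_ m → P m → ∃ (Least P)
    go {m} (acc smaller) pm with anyUpTo? P? m
    ... | yes (r , r<m , pr) = go (smaller r<m) pr
    ... | no none            = m , pm , λ r<m pr → none (_ , r<m , pr)

  ∃-bounded? : Decidable P → ∀ {D} → (∀ {m} → P m → m ≤ D) → Dec (∃ P)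
  ∃-bounded? P? {D} bounded =
    map′ (λ (m , _ , pm) → m , pm) (λ (m , pm) → m , s≤s (bounded pm) , pm) (anyUpTo? P? (suc D))

module _ {X : Set} {P : X → Set} where

  Any-─⁻ : ∀ {Q : X → Set} {xs} (p : Any P xs) → Any Q (xs Any.─ p) → Any Q xs
  Any-─⁻ (here _)  q         = there q
  Any-─⁻ (there p) (here q)  = here q
  Any-─⁻ (there p) (there q) = there (Any-─⁻ p q)

  AllPairs-─⁺ : ∀ {R : X → X → Set} {xs} (p : Any P xs) → AllPairs R xs → AllPairs R (xs Any.─ p)
  AllPairs-─⁺ (here _)  (_ ∷ rest)     = rest
  AllPairs-─⁺ (there p) (first ∷ rest) = All.─⁺ p first ∷ AllPairs-─⁺ p rest

-- Walks, distances and balls in a weighted graph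

module _ {V : Set} where

  PositiveWeights : Adjacency V → Set
  PositiveWeights A = ∀ {x y w} → A x y w → 1 ≤ w

  Undirected : Adjacency V → Set
  Undirected A = ∀ {x y w} → A x y w → A y x w

  WeightsBoundedBy : Adjacency V → ℕ → Set
  WeightsBoundedBy A M = ∀ {x y w} → A x y w → w ≤ M

  Within : Adjacency V → V → ℕ → V → Set
  Within A u r z = ∃[ d ] Dist A u z d × d ≤ r

  Within< : Adjacency V → V → ℕ → V → Set
  Within< A u r z = ∃[ d ] Dist A u z d × d < r

  Reachable : Adjacency V → V → V → Set
  Reachable A u z = ∃ (Dist A u z)

  Far : Adjacency V → ℕ → V → ℕ → Set
  Far A k u d = ∃[ z ] ∃[ h ] HopDist A u z d h × k < h

  walk-map : ∀ {A B : Adjacency V} → (∀ {x y w} → A x y w → B x y w) →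
             ∀ {u v d h} → Walk A u v d h → Walk B u v d h
  walk-map f nil        = nil
  walk-map f (cons a p) = cons (f a) (walk-map f p)

module _ {V : Set} {A : Adjacency V} where

  cast-weight : ∀ {u v d d′ h} → d ≡ d′ → Walk A u v d h → Walk A u v d′ h
  cast-weight refl p = p

  infixr 5 _++ʷ_
  _++ʷ_ : ∀ {u v x d d′ h h′} → Walk A u v d h → Walk A v x d′ h′ → Walk A u x (d + d′) (h + h′)
  nil ++ʷ q = q
  cons {w = w} {W} a p ++ʷ q = cast-weight (sym (+-assoc w W _)) (cons a (p ++ʷ q))

  reverse : Undirected A → ∀ {u v d h} → Walk A u v d h → Walk A v u d h
  reverse undirected nil = nil
  reverse undirected (cons {w = w} {W} {h} a p) =
    subst₂ (Walk A _ _) (trans (cong (W +_) (+-identityʳ w)) (+-comm W w)) (+-comm h 1)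
           (reverse undirected p ++ʷ cons (undirected a) nil)

  cons∸ : ∀ {u v z w d h} → w ≤ d → A u v w → Walk A v z (d ∸ w) h → Walk A u z d (suc h)
  cons∸ w≤d a p = cast-weight (m+[n∸m]≡n w≤d) (cons a p)

  uncons : ∀ {u z d h} → Walk A u z d (suc h) →
           ∃₂ λ v w → w < suc d × A u v w × Walk A v z (d ∸ w) h
  uncons (cons {w = w} {W} a p) =
    _ , w , s≤s (m≤m+n w W) , a , cast-weight (sym (m+n∸m≡n w W)) p

  hops≤weight : PositiveWeights A → ∀ {u v d h} → Walk A u v d h → h ≤ d
  hops≤weight positive nil        = z≤n
  hops≤weight positive (cons a p) = +-mono-≤ (positive a) (hops≤weight positive p)

  weight≤hops*bound : ∀ {M} → WeightsBoundedBy A M → ∀ {u v d h} → Walk A u v d h → d ≤ h * M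
  weight≤hops*bound bounded nil        = z≤n
  weight≤hops*bound bounded (cons a p) = +-mono-≤ (bounded a) (weight≤hops*bound bounded p)

  weight-0⇒≡ : PositiveWeights A → ∀ {u v d h} → Walk A u v d h → d ≡ 0 → u ≡ v
  weight-0⇒≡ positive nil                  _   = refl
  weight-0⇒≡ positive (cons {w = w} a p) d≡0 =
    contradiction (m+n≡0⇒m≡0 w d≡0) (m<n⇒n≢0 (positive a))

  Dist-unique : ∀ {u v d d′} → Dist A u v d → Dist A u v d′ → d ≡ d′
  Dist-unique ((_ , p) , min) ((_ , p′) , min′) = ≤-antisym (min _ _ p′) (min′ _ _ p)

  HopDist-unique : ∀ {u v d d′ h h′} → HopDist A u v d h → HopDist A u v d′ h′ → h ≡ h′
  HopDist-unique (D , p , min) (D′ , p′ , min′) with Dist-unique D D′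
  ... | refl = ≤-antisym (min _ p′) (min′ _ p)

  Dist-sym : Undirected A → ∀ {u v d} → Dist A u v d → Dist A v u d
  Dist-sym undirected ((h , p) , min) =
    (h , reverse undirected p) , λ d′ h′ q → min d′ h′ (reverse undirected q)

  Least⇒Dist : ∀ {u v d} → Least (λ d → ∃ (Walk A u v d)) d → Dist A u v d
  Least⇒Dist l = proj₁ l , λ _ _ p → least-≤ l (_ , p)

  Dist⇒Least : ∀ {u v d} → Dist A u v d → Least (λ d → ∃ (Walk A u v d)) d
  Dist⇒Least (p , min) = p , λ d′<d (_ , q) → <⇒≱ d′<d (min _ _ q)

AtLeast-map : ∀ {V : Set} {ρ} {P Q : V → Set} → (∀ {v} → P v → Q v) → AtLeast ρ P → AtLeast ρ Q
AtLeast-map f (g , injective , ps) = g , injective , f ∘ ps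

module _ {V : Set} {A : Adjacency V} {ρ : ℕ} {u : V} where

  RRho-fin-≤ : ∀ {r r′} → RRho A ρ u (fin r) → AtLeast ρ (Within A u r′) → r ≤ r′
  RRho-fin-≤ {r′ = r′} (_ , ¬closer) close =
    ≮⇒≥ λ r′<r → ¬closer
      (AtLeast-map {P = Within A u r′} (λ (d , D , d≤r′) → d , D , ≤-<-trans d≤r′ r′<r) close)

  RRho-∞-far : ∀ {r} → RRho A ρ u ∞ → ¬ AtLeast ρ (Within A u r)
  RRho-∞-far {r} unreachable close =
    unreachable (AtLeast-map {P = Within A u r} {Reachable A u} (λ (d , D , _) → d , D) close)

  RRho-unique : ∀ {a a′} → RRho A ρ u a → RRho A ρ u a′ → a ≡ a′
  RRho-unique {fin r} {fin r′} ra ra′ =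
    cong fin (≤-antisym (RRho-fin-≤ ra (proj₁ ra′)) (RRho-fin-≤ ra′ (proj₁ ra)))
  RRho-unique {fin r} {∞}      ra ra′ = ⊥-elim (RRho-∞-far ra′ (proj₁ ra))
  RRho-unique {∞}     {fin r′} ra ra′ = ⊥-elim (RRho-∞-far ra (proj₁ ra′))
  RRho-unique {∞}     {∞}      _  _   = refl

  RRho-transport : ∀ {B : Adjacency V} → (∀ {z d} → Dist A u z d → Dist B u z d) →
                   (∀ {z d} → Dist B u z d → Dist A u z d) → ∀ {a} → RRho A ρ u a → RRho B ρ u a
  RRho-transport {B} to from {fin r} (close , ¬closer) =
    AtLeast-map {P = Within A u r} {Within B u r} (λ (d , D , d≤r) → d , to D , d≤r) close ,
    ¬closer ∘ AtLeast-map {P = Within< B u r} {Within< A u r} (λ (d , D , d<r) → d , from D , d<r)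
  RRho-transport {B} to from {∞} unreachable =
    unreachable ∘ AtLeast-map {P = Reachable B u} {Reachable A u} (λ (d , D) → d , from D)

module _ {V : Set} {A : Adjacency V} {k : ℕ} {u : V} where

  RBar-unique : ∀ {b b′} → RBar A k u b → RBar A k u b′ → b ≡ b′
  RBar-unique {fin r} {fin r′} ((z , h , hd , k<h) , min) ((z′ , h′ , hd′ , k<h′) , min′) =
    cong fin (≤-antisym (min z′ r′ h′ hd′ k<h′) (min′ z r h hd k<h))
  RBar-unique {fin r} {∞}  ((z , h , hd , k<h) , _) none = ⊥-elim (none z r h hd k<h)
  RBar-unique {∞} {fin r′} none ((z , h , hd , k<h) , _) = ⊥-elim (none z r′ h hd k<h)
  RBar-unique {∞} {∞}      _ _ = refl

  hasBall? : ∀ {ρ a b} → RRho A ρ u a → RBar A k u b → Dec (HasBall A k ρ u)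
  hasBall? {a = a} {b} ra rb =
    map′ (λ a<b → a , b , ra , rb , a<b)
         (λ (a′ , b′ , ra′ , rb′ , a′<b′) →
            subst₂ _<∞_ (RRho-unique ra′ ra) (RBar-unique rb′ rb) a′<b′)
         (<∞? a b)
    where
    <∞? : ∀ a b → Dec (a <∞ b)
    <∞? (fin a) (fin b) = a <? b
    <∞? (fin a) ∞       = yes tt
    <∞? ∞       _       = no λ ()

  hasBall-if-close : PositiveWeights A → ∀ {ρ a b} → RRho A ρ u a → RBar A k u b →
                     AtLeast ρ (Within A u k) → HasBall A k ρ u
  hasBall-if-close positive {a = ∞} ra _ close = ⊥-elim (RRho-∞-far ra close)
  hasBall-if-close positive {a = fin r} {∞} ra rb close = fin r , ∞ , ra , rb , tt
  hasBall-if-close positive {a = fin r} {fin r̄} ra rb@((_ , _ , (_ , p , _) , k<h) , _) close =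
    fin r , fin r̄ , ra , rb , ≤-<-trans (RRho-fin-≤ ra close) (<-≤-trans k<h (hops≤weight positive p))

-- Adding shortcuts

module _ {V : Set} {A : Adjacency V} where

  addShortcuts-mono : ∀ {S S′} → (∀ {e} → Any (SameEdge e) S′ → Any (SameEdge e) S) →
                      ∀ {x y w} → AddShortcuts A S′ x y w → AddShortcuts A S x y w
  addShortcuts-mono S′⊆S = Sum.map₂ λ (e , D) → S′⊆S e , D

  flatten : ∀ {S u v d h} → Walk (AddShortcuts A S) u v d h → ∃ (Walk A u v d)
  flatten nil                                = 0 , nil
  flatten (cons (inj₁ a) p)                  = _ , cons a (proj₂ (flatten p))
  flatten (cons (inj₂ (_ , ((_ , q) , _))) p) = _ , q ++ʷ proj₂ (flatten p)

  Dist-addShortcuts⁺ : ∀ S {u v d} → Dist A u v d → Dist (AddShortcuts A S) u v d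
  Dist-addShortcuts⁺ S ((h , p) , min) =
    (h , walk-map inj₁ p) , λ d′ _ q → min d′ _ (proj₂ (flatten q))

  Dist-addShortcuts⁻ : ∀ S {u v d} → Dist (AddShortcuts A S) u v d → Dist A u v d
  Dist-addShortcuts⁻ S ((_ , p) , min) = flatten p , λ d′ h′ q → min d′ h′ (walk-map inj₁ q)

  shortcut-ends-distinct : ∀ {S x y} → All (IsShortcut A) S → Any (SameEdge (x , y)) S → x ≢ y
  shortcut-ends-distinct ((u≢v , _) ∷ _) (here (inj₁ (refl , refl))) = u≢v
  shortcut-ends-distinct ((u≢v , _) ∷ _) (here (inj₂ (refl , refl))) = u≢v ∘ sym
  shortcut-ends-distinct (_ ∷ shortcuts) (there e) = shortcut-ends-distinct shortcuts e

  addShortcuts-positive : PositiveWeights A → ∀ {S} → All (IsShortcut A) S →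
                          PositiveWeights (AddShortcuts A S)
  addShortcuts-positive positive _ (inj₁ a) = positive a
  addShortcuts-positive positive shortcuts {w = zero} (inj₂ (e , (_ , p) , _)) =
    contradiction (weight-0⇒≡ positive p refl) (shortcut-ends-distinct shortcuts e)
  addShortcuts-positive positive _ {w = suc _} (inj₂ _) = s≤s z≤n

  addShortcuts-bounded : Undirected A → ∀ {M} → WeightsBoundedBy A M →
                         ∀ {S} → All (IsShortcut A) S → ∃ (WeightsBoundedBy (AddShortcuts A S))
  addShortcuts-bounded undirected {M} bounded [] = M , λ { (inj₁ a) → bounded a ; (inj₂ (() , _)) }
  addShortcuts-bounded undirected bounded ((_ , (d , D) , _) ∷ shortcuts)
    with M , bounded′ ← addShortcuts-bounded undirected bounded shortcuts =
    M ⊔ d , λ where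
      (inj₁ a) → ≤-trans (bounded′ (inj₁ a)) (m≤m⊔n M d)
      (inj₂ (here (inj₁ (refl , refl)) , D′)) → ≤-trans (≤-reflexive (Dist-unique D′ D)) (m≤n⊔m M d)
      (inj₂ (here (inj₂ (refl , refl)) , D′)) →
        ≤-trans (≤-reflexive (Dist-unique (Dist-sym undirected D′) D)) (m≤n⊔m M d)
      (inj₂ (there e , D′)) → ≤-trans (bounded′ (inj₂ (e , D′))) (m≤m⊔n M d)

  module _ (_≟_ : DecidableEquality V) where

    SameEdge? : ∀ p q → Dec (SameEdge p q)
    SameEdge? (a , b) (c , d) = ((a ≟ c) ×-dec (b ≟ d)) ⊎-dec ((a ≟ d) ×-dec (b ≟ c))

    addShortcuts? : (∀ x y w → Dec (A x y w)) → (∀ x y d → Dec (Dist A x y d)) →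
                    ∀ S x y w → Dec (AddShortcuts A S x y w)
    addShortcuts? A? Dist? S x y w = A? x y w ⊎-dec (Any.any? (SameEdge? (x , y)) S ×-dec Dist? x y w)

module Decide {V : Set} (_≟_ : DecidableEquality V) (search : Searchable V)
              {A : Adjacency V} (A? : ∀ x y w → Dec (A x y w)) (positive : PositiveWeights A) where

  walk? : ∀ u z d h → Dec (Walk A u z d h)
  walk? u z d zero =
    map′ (λ { (refl , refl) → nil }) (λ { nil → refl , refl }) ((u ≟ z) ×-dec (d ℕ.≟ 0))
  walk? u z d (suc h) =
    map′ (λ (_ , _ , w<1+d , a , p) → cons∸ (≤-pred w<1+d) a p) uncons
         (search λ v → anyUpTo? (λ w → A? u v w ×-dec walk? v z (d ∸ w) h) (suc d))

  walk-of-weight? : ∀ u z → Decidable (λ d → ∃ (Walk A u z d))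
  walk-of-weight? u z d = ∃-bounded? (walk? u z d) (hops≤weight positive)

  dist? : ∀ u z d → Dec (Dist A u z d)
  dist? u z d = map′ Least⇒Dist Dist⇒Least (least? (walk-of-weight? u z) d)

  within-from-walk : ∀ {u z D h} → Walk A u z D h → Within A u D z
  within-from-walk p with d , l ← least (walk-of-weight? _ _) (_ , p) =
    d , Least⇒Dist l , least-≤ l (_ , p)

  hopDist-from-dist : ∀ {u z d} → Dist A u z d → ∃ (HopDist A u z d)
  hopDist-from-dist D with h , l ← least (walk? _ _ _) (proj₂ (proj₁ D)) =
    h , D , proj₁ l , λ _ → least-≤ l

  far? : ∀ k u → Decidable (Far A k u)
  far? k u d = search far-at?
    where
    far-at? : ∀ z → Dec (∃ λ h → HopDist A u z d h × k < h)
    far-at? z with dist? u z d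
    ... | no ¬D = no λ (_ , hd , _) → ¬D (proj₁ hd)
    ... | yes D with h , hd ← hopDist-from-dist D =
      map′ (λ k<h → h , hd , k<h) (λ (_ , hd′ , k<h′) → subst (k <_) (HopDist-unique hd′ hd) k<h′)
           (k <? h)

  rbar-from-far? : ∀ {k u} → Dec (∃ (Far A k u)) → ∃ (RBar A k u)
  rbar-from-far? (yes (_ , far)) with r , l ← least (far? _ _) far =
    fin r , proj₁ l , λ z d h hd k<h → least-≤ l (z , h , hd , k<h)
  rbar-from-far? (no none) = ∞ , λ z d h hd k<h → none (d , z , h , hd , k<h)

module FiniteGraph {V : Set} (_≟_ : DecidableEquality V) (search : Searchable V)
                   {A : Adjacency V} (A? : ∀ x y w → Dec (A x y w)) (positive : PositiveWeights A)
                   (undirected : Undirected A) {M : ℕ} (bounded : WeightsBoundedBy A M) where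

  open Decide _≟_ search A? positive using (dist?)

  module DecideWith (S : List (V × V)) (shortcuts : All (IsShortcut A) S) =
    Decide _≟_ search (addShortcuts? _≟_ A? dist? S) (addShortcuts-positive positive shortcuts)

  module Removal {k ρ S} (solution : IsSolution A k ρ S) {s} (s∈S : s ∈ S) where

    private
      S′ = S ─ s∈S
      G  = AddShortcuts A S
      G′ = AddShortcuts A S′
      shortcuts  = proj₂ (proj₁ solution)
      shortcuts′ = All.─⁺ s∈S shortcuts
      G-bounded  = addShortcuts-bounded undirected bounded shortcuts
      module D  = DecideWith S shortcuts
      module D′ = DecideWith S′ shortcuts′

    Dist-after-removal : ∀ {u z d} → Dist G u z d → Dist G′ u z d
    Dist-after-removal = Dist-addShortcuts⁺ S′ ∘ Dist-addShortcuts⁻ S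

    Dist-before-removal : ∀ {u z d} → Dist G′ u z d → Dist G u z d
    Dist-before-removal = Dist-addShortcuts⁺ S ∘ Dist-addShortcuts⁻ S′

    hops-grow : ∀ {u z d d′ h h′} → HopDist G u z d h → HopDist G′ u z d′ h′ → h ≤ h′
    hops-grow (D , _ , min) (D′ , p′ , _) with Dist-unique D (Dist-before-removal D′)
    ... | refl = min _ (walk-map (addShortcuts-mono (Any-─⁻ s∈S)) p′)

    far-after-removal : ∀ {u d} → Far G k u d → Far G′ k u d
    far-after-removal (z , h , hd , k<h)
      with h′ , hd′ ← D′.hopDist-from-dist (Dist-after-removal (proj₁ hd)) =
      z , h′ , hd′ , <-≤-trans k<h (hops-grow hd hd′)

    far-bounded : ∀ {u d} → RBar G k u ∞ → Far G′ k u d → d ≤ k * proj₁ G-bounded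
    far-bounded none (z , _ , hd , _)
      with h , hd-G@(_ , p , _) ← D.hopDist-from-dist (Dist-before-removal (proj₁ hd)) =
      ≤-trans (weight≤hops*bound (proj₂ G-bounded) p) (*-monoˡ-≤ _ (≮⇒≥ (none z _ h hd-G)))

    rbar-after-removal : ∀ u → ∃ (RBar G′ k u)
    rbar-after-removal u = D′.rbar-from-far? (far-exists? (proj₂ solution u))
      where
      far-exists? : HasBall G k ρ u → Dec (∃ (Far G′ k u))
      far-exists? (_ , fin r̄ , _ , (far , _) , _) = yes (r̄ , far-after-removal far)
      far-exists? (_ , ∞ , _ , none , _)          = ∃-bounded? (D′.far? k u) (far-bounded none)

    rrho-after-removal : ∀ u → ∃ (RRho G′ ρ u)
    rrho-after-removal u with a , _ , ra , _ ← proj₂ solution u =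
      a , RRho-transport Dist-after-removal Dist-before-removal ra

    hasBall-after-removal? : ∀ u → Dec (HasBall G′ k ρ u)
    hasBall-after-removal? u = hasBall? (proj₂ (rrho-after-removal u)) (proj₂ (rbar-after-removal u))

    close⇒hasBall-after-removal : ∀ {u} → AtLeast ρ (Within A u k) → HasBall G′ k ρ u
    close⇒hasBall-after-removal {u} close =
      hasBall-if-close {A = G′} (addShortcuts-positive positive shortcuts′)
        (proj₂ (rrho-after-removal u)) (proj₂ (rbar-after-removal u))
        (AtLeast-map {P = Within A u k} {Within G′ u k}
                     (λ (d , D , d≤k) → d , Dist-addShortcuts⁺ S′ D , d≤k) close)

    removal-loses-ball : (∀ S″ → IsSolution A k ρ S″ → length S ≤ length S″) →
                         Σ[ v ∈ V ] HasBall G k ρ v × ¬ HasBall G′ k ρ v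
    removal-loses-ball minimal with search (¬? ∘ hasBall-after-removal?)
    ... | yes (v , ¬ball) = v , proj₂ solution v , ¬ball
    ... | no all-balls    = contradiction (minimal S′ solution′) (<⇒≱ shorter)
      where
      shorter : length S′ < length S
      shorter = ≤-reflexive (sym (length-removeAt′ S (index s∈S)))
      solution′ : IsSolution A k ρ S′
      solution′ = (AllPairs-─⁺ s∈S (proj₁ (proj₁ solution)) , shortcuts′) ,
                  λ v → decidable-stable (hasBall-after-removal? v) (λ ¬ball → all-balls (v , ¬ball))

-- The transformed graph

module Transformed (n : ℕ) (E : List (Fin n × Fin n)) (k γ : ℕ) where

  private
    V = VT n E k γ
    c = k ∸ 3
    L = 2 * c + 1

  Code : Set
  Code = Fin n ⊎ (Fin (length E) × Fin L) ⊎ Fin n ⊎ (Fin n × Fin (suc γ))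

  encode : V → Code
  encode (orig x)    = inj₁ x
  encode (inner i j) = inj₂ (inj₁ (i , j))
  encode (base x)    = inj₂ (inj₂ (inj₁ x))
  encode (sat x j)   = inj₂ (inj₂ (inj₂ (x , j)))

  decode : Code → V
  decode (inj₁ x)                    = orig x
  decode (inj₂ (inj₁ (i , j)))        = inner i j
  decode (inj₂ (inj₂ (inj₁ x)))       = base x
  decode (inj₂ (inj₂ (inj₂ (x , j)))) = sat x j

  decode-encode : ∀ v → decode (encode v) ≡ v
  decode-encode (orig _)    = refl
  decode-encode (inner _ _) = refl
  decode-encode (base _)    = refl
  decode-encode (sat _ _)   = refl

  _≟_ : DecidableEquality V
  _≟_ = ≡-dec-retract encode decode decode-encode
          (Sum.≡-dec Fin._≟_ (Sum.≡-dec (Product.≡-dec Fin._≟_ Fin._≟_)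
                                        (Sum.≡-dec Fin._≟_ (Product.≡-dec Fin._≟_ Fin._≟_))))

  search : Searchable V
  search = search-retract encode decode decode-encode
             (search-⊎ Fin.any? (search-⊎ (search-× Fin.any? Fin.any?)
                                          (search-⊎ Fin.any? (search-× Fin.any? Fin.any?))))

  TEdge? : ∀ x y → Dec (TEdge n E k γ x y)
  TEdge? (orig a) (inner i j) =
    map′ (λ { (refl , j≡0) → path-start i j j≡0 }) (λ { (path-start _ _ j≡0) → refl , j≡0 })
         ((a Fin.≟ proj₁ (lookup E i)) ×-dec (toℕ j ℕ.≟ 0))
  TEdge? (inner i j) (inner i′ j′) =
    map′ (λ { (refl , step) → path-step i j j′ step }) (λ { (path-step _ _ _ step) → refl , step })
         ((i Fin.≟ i′) ×-dec (toℕ j′ ℕ.≟ suc (toℕ j)))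
  TEdge? (inner i j) (orig b) =
    map′ (λ { (refl , last) → path-end i j last }) (λ { (path-end _ _ last) → refl , last })
         ((b Fin.≟ proj₂ (lookup E i)) ×-dec (suc (toℕ j) ℕ.≟ L))
  TEdge? (base x) (sat x′ j) =
    map′ (λ { refl → fork-tine x j }) (λ { (fork-tine _ _) → refl }) (x Fin.≟ x′)
  TEdge? (sat x j) (orig x′) =
    map′ (λ { (refl , refl) → fork-link x }) (λ { (fork-link _) → refl , refl })
         ((x Fin.≟ x′) ×-dec (j Fin.≟ fzero))
  TEdge? (orig _)    (orig _)    = no λ ()
  TEdge? (orig _)    (base _)    = no λ ()
  TEdge? (orig _)    (sat _ _)   = no λ ()
  TEdge? (inner _ _) (base _)    = no λ ()
  TEdge? (inner _ _) (sat _ _)   = no λ ()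
  TEdge? (base _)    (orig _)    = no λ ()
  TEdge? (base _)    (inner _ _) = no λ ()
  TEdge? (base _)    (base _)    = no λ ()
  TEdge? (sat _ _)   (inner _ _) = no λ ()
  TEdge? (sat _ _)   (base _)    = no λ ()
  TEdge? (sat _ _)   (sat _ _)   = no λ ()

  GT? : ∀ x y w → Dec (GT n E k γ x y w)
  GT? x y w = (w ℕ.≟ 1) ×-dec (TEdge? x y ⊎-dec TEdge? y x)

  GT-positive : PositiveWeights (GT n E k γ)
  GT-positive (refl , _) = ≤-refl

  GT-undirected : Undirected (GT n E k γ)
  GT-undirected (w≡1 , e) = w≡1 , Sum.swap e

  GT-bounded : WeightsBoundedBy (GT n E k γ) 1
  GT-bounded (refl , _) = ≤-refl

  isEdgeNode? : (v : V) → Dec (IsEdgeNode v)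
  isEdgeNode? (orig _)    = no λ ()
  isEdgeNode? (inner _ j) = toℕ j ℕ.≟ c
  isEdgeNode? (base _)    = no λ ()
  isEdgeNode? (sat _ _)   = no λ ()

  private
    UnitWalk : V → V → ℕ → Set
    UnitWalk u v h = Walk (GT n E k γ) u v h h

    forward : ∀ {x y} → TEdge n E k γ x y → GT n E k γ x y 1
    forward e = refl , inj₁ e

    backward : ∀ {x y} → TEdge n E k γ y x → GT n E k γ x y 1
    backward e = refl , inj₂ e

  to-start : ∀ i m (j : Fin L) → toℕ j ≡ m →
             UnitWalk (inner i j) (orig (proj₁ (lookup E i))) (suc m)
  to-start i zero    j j≡0   = cons (backward (path-start i j j≡0)) nil
  to-start i (suc m) j j≡1+m = cons (backward (path-step i j′ j (trans j≡1+m (cong suc (sym j′≡m)))))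
                                    (to-start i m j′ j′≡m)
    where
    m<L : m < L
    m<L = <-trans (n<1+n m) (subst (_< L) j≡1+m (Fin.toℕ<n j))
    j′ = fromℕ< m<L
    j′≡m = Fin.toℕ-fromℕ< m<L

  to-end : ∀ i t (j : Fin L) → suc (toℕ j) + t ≡ L →
           UnitWalk (inner i j) (orig (proj₂ (lookup E i))) (suc t)
  to-end i zero    j last = cons (forward (path-end i j (trans (sym (+-identityʳ _)) last))) nil
  to-end i (suc t) j rest = cons (forward (path-step i j j′ j′≡1+j)) (to-end i t j′ rest′)
    where
    1+j<L : suc (toℕ j) < L
    1+j<L = subst (suc (toℕ j) <_) rest (m<m+n (suc (toℕ j)) (s≤s z≤n))
    j′ = fromℕ< 1+j<L
    j′≡1+j = Fin.toℕ-fromℕ< 1+j<L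
    rest′ : suc (toℕ j′) + t ≡ L
    rest′ = trans (cong (λ m → suc m + t) j′≡1+j) (trans (sym (+-suc (suc (toℕ j)) t)) rest)

  -- The node w_{u,v} sits at position c of the 2c + 1 inner nodes, so every other inner node is
  -- at most c steps from an end of its path.
  beyond-middle-short : ∀ {j t} → c < j → suc j + t ≡ L → suc t ≤ c
  beyond-middle-short {j} {t} c<j rest = +-cancelˡ-≤ (suc c) _ _ (begin
    suc c + suc t     ≡⟨ +-suc (suc c) t ⟩
    suc (suc c) + t   ≤⟨ +-monoˡ-≤ t (s≤s c<j) ⟩
    suc j + t         ≡⟨ rest ⟩
    2 * c + 1         ≡⟨ +-comm (2 * c) 1 ⟩
    suc (c + (c + 0)) ≡⟨ cong (λ x → suc (c + x)) (+-identityʳ c) ⟩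
    suc c + c         ∎)
    where open ≤-Reasoning

  to-endpoint : ∀ i j → toℕ j ≢ c → ∃₂ λ x t → UnitWalk (inner i j) (orig x) t × t ≤ c
  to-endpoint i j j≢c with <-cmp (toℕ j) c
  ... | tri< j<c _ _ = _ , _ , to-start i (toℕ j) j refl , j<c
  ... | tri≈ _ j≡c _ = contradiction j≡c j≢c
  ... | tri> _ _ c<j = _ , _ , to-end i t j rest , beyond-middle-short c<j rest
    where
    t = L ∸ suc (toℕ j)
    rest = m+[n∸m]≡n (Fin.toℕ<n j)

  orig-to-base : ∀ x → UnitWalk (orig x) (base x) 2
  orig-to-base x = cons (backward (fork-link x)) (cons (backward (fork-tine x fzero)) nil)

  to-base : 3 ≤ k → ∀ v → ¬ IsEdgeNode v → ∃₂ λ x t → UnitWalk v (base x) t × t < k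
  to-base 3≤k (orig x)  _ = x , 2 , orig-to-base x , 3≤k
  to-base 3≤k (base x)  _ = x , 0 , nil , ≤-trans (s≤s z≤n) 3≤k
  to-base 3≤k (sat x j) _ = x , 1 , cons (backward (fork-tine x j)) nil , ≤-trans (s≤s (s≤s z≤n)) 3≤k
  to-base 3≤k (inner i j) j≢c with x , t , p , t≤c ← to-endpoint i j j≢c =
    x , t + 2 , p ++ʷ orig-to-base x , (begin-strict
      t + 2 <⟨ +-monoʳ-< t (n<1+n 2) ⟩
      t + 3 ≤⟨ +-monoˡ-≤ 3 t≤c ⟩
      c + 3 ≡⟨ m∸n+n≡m 3≤k ⟩
      k     ∎)
    where open ≤-Reasoning

  open Decide _≟_ search GT? GT-positive using (within-from-walk)

  nonEdgeNode-close : 3 ≤ k → ∀ {v} → ¬ IsEdgeNode v → AtLeast γ (Within (GT n E k γ) v k)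
  nonEdgeNode-close 3≤k {v} ¬edge with x , t , p , t<k ← to-base 3≤k v ¬edge =
    (λ i → sat x (fsuc i)) , (λ { refl → refl }) , close
    where
    close : ∀ i → Within (GT n E k γ) v k (sat x (fsuc i))
    close i with d , D , d≤t+1 ← within-from-walk (p ++ʷ cons (forward (fork-tine x (fsuc i))) nil) =
      d , D , ≤-trans d≤t+1 (subst (_≤ k) (+-comm 1 t) t<k)

lemma15 : (n : ℕ) (E : List (Fin n × Fin n)) → SimpleEdgeList n E →
          (k γ : ℕ) → 3 ≤ k → 7 * n + 6 ≤ γ →
          (S : List (VT n E k γ × VT n E k γ)) →
          IsOptimalSolution (GT n E k γ) k γ S →
          ∀ {s} (s∈S : s ∈ S) →
          Σ[ v ∈ VT n E k γ ] IsEdgeNode v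
            × HasBall (AddShortcuts (GT n E k γ) S) k γ v
            × ¬ HasBall (AddShortcuts (GT n E k γ) (S ─ s∈S)) k γ v
lemma15 n E _ k γ 3≤k _ S (solution , minimal) s∈S =
  let v , ball , ¬ball′ = removal-loses-ball minimal in
  v , ball-lost⇒IsEdgeNode v ¬ball′ , ball , ¬ball′
  where
  open Transformed n E k γ
  open FiniteGraph _≟_ search GT? GT-positive GT-undirected GT-bounded
  open Removal solution s∈S
  ball-lost⇒IsEdgeNode : ∀ v → ¬ HasBall (AddShortcuts (GT n E k γ) (S ─ s∈S)) k γ v → IsEdgeNode v
  ball-lost⇒IsEdgeNode v ¬ball′ =
    decidable-stable (isEdgeNode? v) (¬ball′ ∘ close⇒hasBall-after-removal ∘ nonEdgeNode-close 3≤k)
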